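{- Let $S$ be a solid and let $x,y,z\in S$. If $e(x)(y+z)\ne e(x)y+e(x)z$, then $e(x)y=e(x)z$.
   Context: A solid is a set $S$ with binary operations $+$ and $\cdot$ and a relation $\le$ satisfying: (1) $+$ is associative and commutative; for every $x$ there is a unique $e$ with $x+e=x$ and $e+f=e$ whenever $x+f=x$, written $e(x)$ (the magnitude of $x$); for every $x$ there is $s$ with $x+s=e(x)$ and $e(s)=e(x)$, written $-x$; $e(x+y)=e(x)$ or $e(x+y)=e(y)$. (2) $\cdot$ is associative and commutative; for every $x\ne e(x)$ there is a unique $u$ with $xu=x$ and $uv=u$ whenever $xv=x$, written $u(x)$; for every $x\ne e(x)$ there is $d$ with $xd=u(x)$ and $u(d)=u(x)$, written $x^{ -1}$; for $x\ne e(x),y\ne e(y)$: $u(xy)=u(x)$ or $u(xy)=u(y)$. (3) $\le$ is a total order; $x\le y\Rightarrow x+z\le y+z$; $y+e(x)=e(x)\Rightarrow (y\le e(x)$ and $-y\le e(x))$; $(e(x)<x$ and $y\le z)\Rightarrow xy\le xz$; $e(y)\le y\le z\Rightarrow e(x)y\le e(x)z$. (4) For all $x,y$ there is $z$ with $e(x)y=e(z)$; $e(xy)=e(x)y+e(y)x$; for $x\ne e(x)$, $e(u(x))=e(x)x^{ -1}$; $xy+xz=x(y+z)+e(x)y+e(x)z$; $-(xy)=(-x)y$. (5) There is $0$ with $0+x=x$ for all $x$; there is $1$ with $1x=x$ for all $x$; there is $M$ with $e(x)+M=M$ for all $x$; there is $x$ with $e(x)\ne 0$ and $e(x)\ne M$;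 for every $x$ there is $a$ with $x=a+e(x)$ and $e(a)=0$; if $x=e(x)$, $y=e(y)$ and $x<y$ then there is $z\ne e(z)$ with $x<z<y$. -}

module Defs where

open import Level using (Level; _⊔_) renaming (suc to lsuc)
open import Data.Product using (Σ; _×_; _,_; ∃)
open import Data.Sum using (_⊎_)
open import Relation.Nullary using (¬_)
open import Relation.Binary.PropositionalEquality using (_≡_; _≢_)
open import Relation.Binary.Structures using (IsTotalOrder)

-- The operations e (magnitude), neg (-x), u (unit of x) and inv (x⁻¹),
-- which the paper introduces by "there is (a unique) ... written ...",
-- are given as total functions whose defining properties are fields;
-- for u and inv the properties are only required when x ≢ e x.
record Solid (c : Level) : Set (lsuc c) where
  infixl 6 _+_
  infixl 7 _·_
  infix 4 _≤_ _<_
  field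
    Carrier : Set c
    _+_ _·_ : Carrier → Carrier → Carrier
    _≤_     : Carrier → Carrier → Set c
    e neg u inv : Carrier → Carrier
    zero one M : Carrier

  _<_ : Carrier → Carrier → Set c
  x < y = x ≤ y × x ≢ y

  field
    +-assoc : ∀ x y z → (x + y) + z ≡ x + (y + z)
    +-comm  : ∀ x y → x + y ≡ y + x
    e-neutral : ∀ x → x + e x ≡ x
    e-minimal : ∀ x f → x + f ≡ x → e x + f ≡ e x
    neg-inv : ∀ x → x + neg x ≡ e x
    neg-e   : ∀ x → e (neg x) ≡ e x
    e-+     : ∀ x y → e (x + y) ≡ e x ⊎ e (x + y) ≡ e y
    ·-assoc : ∀ x y z → (x · y) · z ≡ x · (y · z)
    ·-comm  : ∀ x y → x · y ≡ y · x
    u-neutral : ∀ x → x ≢ e x → x · u x ≡ x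
    u-minimal : ∀ x v → x ≢ e x → x · v ≡ x → u x · v ≡ u x
    inv-inv : ∀ x → x ≢ e x → x · inv x ≡ u x
    inv-u   : ∀ x → x ≢ e x → u (inv x) ≡ u x
    u-·     : ∀ x y → x ≢ e x → y ≢ e y → u (x · y) ≡ u x ⊎ u (x · y) ≡ u y
    ≤-isTotalOrder : IsTotalOrder _≡_ _≤_
    ≤-+ : ∀ x y z → x ≤ y → x + z ≤ y + z
    ≤-absorbed : ∀ x y → y + e x ≡ e x → (y ≤ e x × neg y ≤ e x)
    ≤-·pos : ∀ x y z → e x < x → y ≤ z → x · y ≤ x · z
    ≤-·e   : ∀ x y z → e y ≤ y → y ≤ z → e x · y ≤ e x · z
    e·-is-e : ∀ x y → ∃ λ z → e x · y ≡ e z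
    e-· : ∀ x y → e (x · y) ≡ e x · y + e y · x
    e-u : ∀ x → x ≢ e x → e (u x) ≡ e x · inv x
    distrib : ∀ x y z → x · y + x · z ≡ x · (y + z) + e x · y + e x · z
    neg-· : ∀ x y → neg (x · y) ≡ neg x · y
    zero-id : ∀ x → zero + x ≡ x
    one-id  : ∀ x → one · x ≡ x
    M-max   : ∀ x → e x + M ≡ M
    nontrivial : ∃ λ x → e x ≢ zero × e x ≢ M
    decomp : ∀ x → ∃ λ a → x ≡ a + e x × e a ≡ zero
    dense : ∀ x y → x ≡ e x → y ≡ e y → x < y → ∃ λ z → z ≢ e z × x < z × z < y

module Submission where

open import Defs
open import Level using (Level)
open import Algebra.Bundles using (CommutativeSemigroup)
import Algebra.Properties.CommutativeSemigroup as CommutativeSemigroupProperties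
open import Data.Product using (_,_; proj₁)
open import Data.Sum using (_⊎_; inj₁; inj₂)
import Data.Sum as Sum
open import Data.Empty using (⊥-elim)
open import Relation.Binary.PropositionalEquality
open import Relation.Binary.Structures using (IsTotalOrder)

-- Magnitudes form a chain on which + is the maximum, and e x · v is always a
-- magnitude.  Write p = e x · y, q = e x · z, w = e x · (y + z).  Distributivity
-- gives w ≤ p + q, and applied to (y + z) and -z (using e x · (-z) = q) it gives
-- p ≤ w + q, as p ≤ e x · (y + e z).  If p + q = p and w ≠ p, then w + q cannot
-- be w (that would force w = p), so p ≤ w + q = q ≤ p.

module SolidProperties {c : Level} (S : Solid c) where
  open Solid S
  open IsTotalOrder ≤-isTotalOrder using (antisym; total)
  open ≡-Reasoning

  +-commutativeSemigroup : CommutativeSemigroup c c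
  +-commutativeSemigroup = record
    { Carrier = Carrier
    ; _≈_ = _≡_
    ; _∙_ = _+_
    ; isCommutativeSemigroup = record
      { isSemigroup = record
        { isMagma = record { isEquivalence = isEquivalence ; ∙-cong = cong₂ _+_ }
        ; assoc = +-assoc
        }
      ; comm = +-comm
      }
    }

  open CommutativeSemigroupProperties +-commutativeSemigroup using (interchange; x∙yz≈y∙xz)

  Magnitude : Carrier → Set c
  Magnitude P = e P ≡ P

  magnitude-+-idem : ∀ {P} → Magnitude P → P + P ≡ P
  magnitude-+-idem {P} hP = trans (cong (P +_) (sym hP)) (e-neutral P)

  e-magnitude : ∀ v → Magnitude (e v)
  e-magnitude v = begin
    e (e v)           ≡⟨ sym (e-minimal (e v) (e v) (e-minimal v (e v) (e-neutral v))) ⟩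
    e (e v) + e v     ≡⟨ +-comm (e (e v)) (e v) ⟩
    e v + e (e v)     ≡⟨ e-neutral (e v) ⟩
    e v               ∎

  magnitude-absorbs : ∀ {P} → Magnitude P → ∀ Q → P + (P + Q) ≡ P + Q
  magnitude-absorbs {P} hP Q = trans (sym (+-assoc P P Q)) (cong (_+ Q) (magnitude-+-idem hP))

  e-homo-+ : ∀ a b → e (a + b) ≡ e a + e b
  e-homo-+ a b = trans (sym e[a+b]-absorbs) (by-cases (e-+ a b))
    where
      e[a+b]-absorbs : e (a + b) + (e a + e b) ≡ e (a + b)
      e[a+b]-absorbs = e-minimal (a + b) (e a + e b)
        (trans (interchange a b (e a) (e b)) (cong₂ _+_ (e-neutral a) (e-neutral b)))
      by-cases : e (a + b) ≡ e a ⊎ e (a + b) ≡ e b → e (a + b) + (e a + e b) ≡ e a + e b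
      by-cases (inj₁ h) rewrite h = magnitude-absorbs (e-magnitude a) (e b)
      by-cases (inj₂ h) rewrite h =
        trans (x∙yz≈y∙xz (e b) (e a) (e b)) (cong (e a +_) (magnitude-+-idem (e-magnitude b)))

  magnitude-+ : ∀ {P Q} → Magnitude P → Magnitude Q → Magnitude (P + Q)
  magnitude-+ {P} {Q} hP hQ = trans (e-homo-+ P Q) (cong₂ _+_ hP hQ)

  magnitude-+-sel : ∀ {P Q} → Magnitude P → Magnitude Q → P + Q ≡ P ⊎ P + Q ≡ Q
  magnitude-+-sel {P} {Q} hP hQ =
    Sum.map (λ h → trans (sym P+Q) (trans h hP)) (λ h → trans (sym P+Q) (trans h hQ)) (e-+ P Q)
    where P+Q = magnitude-+ hP hQ

  neg-unique : ∀ s t → s + t ≡ e s → e t ≡ e s → t ≡ neg s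
  neg-unique s t s+t≡es et≡es = sym (begin
    neg s               ≡⟨ sym (e-neutral (neg s)) ⟩
    neg s + e (neg s)   ≡⟨ cong (neg s +_) (trans (neg-e s) (sym s+t≡es)) ⟩
    neg s + (s + t)     ≡⟨ sym (+-assoc (neg s) s t) ⟩
    (neg s + s) + t     ≡⟨ cong (_+ t) (trans (+-comm (neg s) s) (neg-inv s)) ⟩
    e s + t             ≡⟨ cong (_+ t) (sym et≡es) ⟩
    e t + t             ≡⟨ +-comm (e t) t ⟩
    t + e t             ≡⟨ e-neutral t ⟩
    t                   ∎)

  neg-magnitude : ∀ {P} → Magnitude P → neg P ≡ P
  neg-magnitude {P} hP = sym (neg-unique P P (trans (magnitude-+-idem hP) (sym hP)) refl)

  neg-+-magnitude : ∀ y {C} → Magnitude C → neg (y + C) ≡ neg y + C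
  neg-+-magnitude y {C} hC = sym (neg-unique (y + C) (neg y + C) inverse same-e)
    where
      e[y+C] : e (y + C) ≡ e y + C
      e[y+C] = trans (e-homo-+ y C) (cong (e y +_) hC)
      inverse : (y + C) + (neg y + C) ≡ e (y + C)
      inverse = trans (interchange y C (neg y) C)
                      (trans (cong₂ _+_ (neg-inv y) (magnitude-+-idem hC)) (sym e[y+C]))
      same-e : e (neg y + C) ≡ e (y + C)
      same-e = trans (e-homo-+ (neg y) C) (trans (cong₂ _+_ (neg-e y) hC) (sym e[y+C]))

  magnitude-≤⇒+≡ : ∀ {P Q} → Magnitude P → Magnitude Q → P ≤ Q → P + Q ≡ Q
  magnitude-≤⇒+≡ {P} {Q} hP hQ P≤Q with magnitude-+-sel hP hQ
  ... | inj₂ P+Q≡Q = P+Q≡Q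
  ... | inj₁ P+Q≡P = trans P+Q≡P (antisym P≤Q Q≤P)
    where
      Q-absorbed : Q + e P ≡ e P
      Q-absorbed = trans (cong (Q +_) hP) (trans (+-comm Q P) (trans P+Q≡P (sym hP)))
      Q≤P : Q ≤ P
      Q≤P = subst (Q ≤_) hP (proj₁ (≤-absorbed P Q Q-absorbed))

  zero≤magnitude : ∀ {C} → Magnitude C → zero ≤ C
  zero≤magnitude {C} hC = subst (zero ≤_) hC (proj₁ (≤-absorbed C zero (zero-id (e C))))

  ≤-+-magnitude : ∀ y {C} → Magnitude C → y ≤ y + C
  ≤-+-magnitude y {C} hC = subst₂ _≤_ (zero-id y) (+-comm C y) (≤-+ zero C y (zero≤magnitude hC))

  ≤e⇒e≤neg : ∀ {y} → y ≤ e y → e (neg y) ≤ neg y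
  ≤e⇒e≤neg {y} y≤ey = subst₂ _≤_ y-neg-y ey-neg-y (≤-+ y (e y) (neg y) y≤ey)
    where
      y-neg-y : y + neg y ≡ e (neg y)
      y-neg-y = trans (neg-inv y) (sym (neg-e y))
      ey-neg-y : e y + neg y ≡ neg y
      ey-neg-y = trans (+-comm (e y) (neg y))
                       (trans (cong (neg y +_) (sym (neg-e y))) (e-neutral (neg y)))

  e·-magnitude : ∀ x v → Magnitude (e x · v)
  e·-magnitude x v with e·-is-e x v
  ... | k , eq = trans (cong e eq) (trans (e-magnitude k) (sym eq))

  e·-neg : ∀ x v → e x · neg v ≡ e x · v
  e·-neg x v = begin
    e x · neg v     ≡⟨ ·-comm (e x) (neg v) ⟩
    neg v · e x     ≡⟨ sym (neg-· v (e x)) ⟩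
    neg (v · e x)   ≡⟨ cong neg (·-comm v (e x)) ⟩
    neg (e x · v)   ≡⟨ neg-magnitude (e·-magnitude x v) ⟩
    e x · v         ∎

  -- For y below its magnitude, pass to -y, which e x · _ does not see.
  e·-monoʳ-+-magnitude : ∀ x y {C} → Magnitude C → e x · y ≤ e x · (y + C)
  e·-monoʳ-+-magnitude x y {C} hC with total (e y) y
  ... | inj₁ ey≤y = ≤-·e x y (y + C) ey≤y (≤-+-magnitude y hC)
  ... | inj₂ y≤ey = subst₂ _≤_ (e·-neg x y) e·[neg-y+C]
                      (≤-·e x (neg y) (neg y + C) (≤e⇒e≤neg y≤ey) (≤-+-magnitude (neg y) hC))
    where
      e·[neg-y+C] : e x · (neg y + C) ≡ e x · (y + C)
      e·[neg-y+C] = trans (cong (e x ·_) (sym (neg-+-magnitude y hC))) (e·-neg x (y + C))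

  e·-distrib : ∀ x y z → e x · y + e x · z ≡ e x · (y + z) + e x · y + e x · z
  e·-distrib x y z =
    trans (distrib (e x) y z) (cong (λ t → e x · (y + z) + t · y + t · z) (e-magnitude x))

  e·[y+z]-absorbed : ∀ x y z → e x · (y + z) + (e x · y + e x · z) ≡ e x · y + e x · z
  e·[y+z]-absorbed x y z = trans (sym (+-assoc (e x · (y + z)) (e x · y) (e x · z))) (sym (e·-distrib x y z))

  e·y-absorbed : ∀ x y z → e x · y + (e x · (y + z) + e x · z) ≡ e x · (y + z) + e x · z
  e·y-absorbed x y z = begin
    p + (w + q)         ≡⟨ cong (p +_) w+q≡m+w+q ⟩
    p + ((m + w) + q)   ≡⟨ sym (+-assoc p (m + w) q) ⟩
    (p + (m + w)) + q   ≡⟨ cong (_+ q) (sym (+-assoc p m w)) ⟩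
    ((p + m) + w) + q   ≡⟨ cong (λ t → (t + w) + q) p+m≡m ⟩
    (m + w) + q         ≡⟨ sym w+q≡m+w+q ⟩
    w + q               ∎
    where
      p = e x · y
      q = e x · z
      w = e x · (y + z)
      m = e x · (y + e z)
      p+m≡m : p + m ≡ m
      p+m≡m = magnitude-≤⇒+≡ (e·-magnitude x y) (e·-magnitude x (y + e z))
                (e·-monoʳ-+-magnitude x y (e-magnitude z))
      y+z-z : (y + z) + neg z ≡ y + e z
      y+z-z = trans (+-assoc y z (neg z)) (cong (y +_) (neg-inv z))
      w+q≡m+w+q : w + q ≡ (m + w) + q
      w+q≡m+w+q = begin
        w + q                                         ≡⟨ cong (w +_) (sym (e·-neg x z)) ⟩
        w + e x · neg z                               ≡⟨ e·-distrib x (y + z) (neg z) ⟩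
        e x · ((y + z) + neg z) + w + e x · neg z     ≡⟨ cong₂ (λ s t → e x · s + w + t) y+z-z (e·-neg x z) ⟩
        (m + w) + q                                   ∎

  e·-+-dominant⇒equal : ∀ x y z → e x · y + e x · z ≡ e x · y →
                        e x · (y + z) ≢ e x · y → e x · y ≡ e x · z
  e·-+-dominant⇒equal x y z p+q≡p w≢p with magnitude-+-sel (e·-magnitude x (y + z)) (e·-magnitude x z)
  ... | inj₁ w+q≡w = ⊥-elim (w≢p (begin
    w        ≡⟨ sym (subst (λ t → p + t ≡ t) w+q≡w (e·y-absorbed x y z)) ⟩
    p + w    ≡⟨ +-comm p w ⟩
    w + p    ≡⟨ subst (λ t → w + t ≡ t) p+q≡p (e·[y+z]-absorbed x y z) ⟩
    p        ∎))
    where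
      p = e x · y
      w = e x · (y + z)
  ... | inj₂ w+q≡q = trans (sym p+q≡p) (subst (λ t → e x · y + t ≡ t) w+q≡q (e·y-absorbed x y z))

lemma4p9 : ∀ {c} (S : Solid c) → let open Solid S in
    ∀ x y z → e x · (y + z) ≢ e x · y + e x · z → e x · y ≡ e x · z
lemma4p9 S x y z w≢p+q =
  Sum.[ p-dominant , q-dominant ]′ (magnitude-+-sel (e·-magnitude x y) (e·-magnitude x z))
  where
    open Solid S
    open SolidProperties S
    p-dominant : e x · y + e x · z ≡ e x · y → e x · y ≡ e x · z
    p-dominant p+q≡p =
      e·-+-dominant⇒equal x y z p+q≡p (λ w≡p → w≢p+q (trans w≡p (sym p+q≡p)))
    q-dominant : e x · y + e x · z ≡ e x · z → e x · y ≡ e x · z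
    q-dominant p+q≡q = sym (e·-+-dominant⇒equal x z y (trans (+-comm (e x · z) (e x · y)) p+q≡q)
      (λ w≡q → w≢p+q (trans (cong (e x ·_) (+-comm y z)) (trans w≡q (sym p+q≡q)))))
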